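{- Let $v\ge 2$ and $s\ge 2$ be integers. If there is a $(2,s,v)$-AONT, then $s\le v+1$.
   Context: A $(t,s,v)$-all-or-nothing transform (AONT) over an alphabet $X$ with $|X|=v$ (where $1\le t\le s$) is a bijection $\phi: X^s\to X^s$ such that for every $I\subseteq\{1,\dots,s\}$ with $|I|=t$ and every $J\subseteq\{1,\dots,s\}$ with $|J|=t$, for every $\mathbf{a}\in X^{I}$ and every $\mathbf{b}\in X^{\{1,\dots,s\}\setminus J}$ there is exactly one $\mathbf{x}\in X^s$ with $\mathbf{x}|_I=\mathbf{a}$ and $\phi(\mathbf{x})|_{\{1,\dots,s\}\setminus J}=\mathbf{b}$ (i.e., given any $s-t$ outputs, any $t$ inputs are completely undetermined). -}

module Defs where

open import Data.Nat using (ℕ)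
open import Data.Fin using (Fin)
open import Data.Fin.Subset using (Subset; _∈_; _∉_; ∣_∣)
open import Data.Vec using (Vec; lookup)
open import Data.Product using (∃; _×_)
open import Function.Bundles using (_⤖_; Bijection)
open import Relation.Binary.PropositionalEquality using (_≡_)

-- Words of length s over the alphabet X = Fin v (any v-element alphabet is
-- equivalent up to relabelling).
Word : ℕ → ℕ → Set
Word s v = Vec (Fin v) s

AgreeOn : ∀ {s v} → Subset s → Word s v → Word s v → Set
AgreeOn I x a = ∀ i → i ∈ I → lookup x i ≡ lookup a i

AgreeOff : ∀ {s v} → Subset s → Word s v → Word s v → Set
AgreeOff J x b = ∀ i → i ∉ J → lookup x i ≡ lookup b i

-- Elements of X^I (resp. X^{[s]∖J}) are
-- represented by full words, of which only the relevant coordinates matter.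
record IsAONT (t s v : ℕ) (φ : Word s v ⤖ Word s v) : Set where
  open Bijection φ renaming (to to f)
  field
    exactlyOne : (I J : Subset s) → ∣ I ∣ ≡ t → ∣ J ∣ ≡ t →
      (a b : Word s v) →
      ∃ λ x → (AgreeOn I x a × AgreeOff J (f x) b) ×
        (∀ y → AgreeOn I y a → AgreeOff J (f y) b → y ≡ x)

AONT : ℕ → ℕ → ℕ → Set
AONT t s v = ∃ λ (φ : Word s v ⤖ Word s v) → IsAONT t s v φ

-- Fix two output positions J and the values b of the other s − 2 outputs.
-- The preimage of b is an orthogonal array of strength 2 and index 1 with s
-- columns over v symbols: any two inputs can be prescribed, and then the
-- input word is unique. In such an array fix a row r. For each column i and
-- each of the v − 1 symbols t other than r's entry in a second column c(i),
-- the row with r's entry at i and t at c(i) differs from r; rows obtained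
-- for different columns i ≠ j differ too, since a common row would share two
-- entries with r and so be r. These 1 + s(v − 1) rows are distinct, hence so
-- are their entries in two fixed columns, whence 1 + s(v − 1) ≤ v², that is
-- s ≤ v + 1 for v ≥ 2.
module Submission where

open import Defs
open import Data.Nat using (ℕ; zero; suc; _+_; _*_; _≤_; s≤s)
open import Data.Nat.Properties using (*-cancelʳ-≤; ≤-pred; ≤-trans; ≤-reflexive)
open import Data.Nat.Tactic.RingSolver using (solve-∀)
open import Data.Fin using (Fin; zero; suc)
open import Data.Fin.Properties using (injective⇒≤; +↔⊎; *↔×; suc-injective; _≟_)
open import Data.Fin.Subset using (Subset; ⁅_⁆; _∪_; ∣_∣; _∈_)
open import Data.Fin.Subset.Properties
  using (∪-identityˡ; ∪-identityʳ; ∣⁅x⁆∣≡1; x∈⁅x⁆; x∈⁅y⁆⇒x≡y; x∈p∪q⁺; x∈p∪q⁻)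
open import Data.Vec using (lookup; replicate; _[_]≔_)
open import Data.Vec.Properties using (lookup∘update; lookup∘update′; lookup-replicate)
open import Data.Product using (_×_; _,_)
open import Data.Product.Properties using (,-injective)
open import Data.Sum using (_⊎_; inj₁; inj₂)
open import Data.Sum.Function.Propositional using (_⊎-↔_)
open import Data.Empty using (⊥-elim)
open import Relation.Nullary using (yes; no)
open import Relation.Binary.PropositionalEquality
  using (_≡_; _≢_; refl; sym; trans; cong; module ≡-Reasoning)
open import Function using (_∘′_)
open import Function.Bundles using (_⤖_; _↔_; _↣_; Bijection; Injection; mk↣)
open import Function.Properties.Inverse using (↔⇒↣; ↔-sym; ↔-trans; ↔-refl)
open import Function.Properties.Injection using (↣-trans)

↣⇒≤ : ∀ {m n} {A B : Set} → Fin m ↔ A → Fin n ↔ B → A ↣ B → m ≤ n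
↣⇒≤ m↔A n↔B A↣B =
  injective⇒≤ (Injection.injective (↣-trans (↔⇒↣ m↔A) (↣-trans A↣B (↔⇒↣ (↔-sym n↔B)))))

∣⁅i⁆∪⁅k⁆∣≡2 : ∀ {n} {i k : Fin n} → i ≢ k → ∣ ⁅ i ⁆ ∪ ⁅ k ⁆ ∣ ≡ 2
∣⁅i⁆∪⁅k⁆∣≡2 {i = zero}  {zero}  i≢k = ⊥-elim (i≢k refl)
∣⁅i⁆∪⁅k⁆∣≡2 {i = zero}  {suc k} _   rewrite ∪-identityˡ ⁅ k ⁆ = cong suc (∣⁅x⁆∣≡1 k)
∣⁅i⁆∪⁅k⁆∣≡2 {i = suc i} {zero}  _   rewrite ∪-identityʳ ⁅ i ⁆ = cong suc (∣⁅x⁆∣≡1 i)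
∣⁅i⁆∪⁅k⁆∣≡2 {i = suc i} {suc k} i≢k = ∣⁅i⁆∪⁅k⁆∣≡2 (i≢k ∘′ cong suc)

i∈⁅i⁆∪⁅k⁆ : ∀ {n} (i k : Fin n) → i ∈ ⁅ i ⁆ ∪ ⁅ k ⁆
i∈⁅i⁆∪⁅k⁆ i k = x∈p∪q⁺ (inj₁ (x∈⁅x⁆ i))

k∈⁅i⁆∪⁅k⁆ : ∀ {n} (i k : Fin n) → k ∈ ⁅ i ⁆ ∪ ⁅ k ⁆
k∈⁅i⁆∪⁅k⁆ i k = x∈p∪q⁺ (inj₂ (x∈⁅x⁆ k))

x∈⁅i⁆∪⁅k⁆⇒x≡i⊎x≡k : ∀ {n} {x} (i k : Fin n) → x ∈ ⁅ i ⁆ ∪ ⁅ k ⁆ → x ≡ i ⊎ x ≡ k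
x∈⁅i⁆∪⁅k⁆⇒x≡i⊎x≡k i k x∈ with x∈p∪q⁻ ⁅ i ⁆ ⁅ k ⁆ x∈
... | inj₁ x∈⁅i⁆ = inj₁ (x∈⁅y⁆⇒x≡y i x∈⁅i⁆)
... | inj₂ x∈⁅k⁆ = inj₂ (x∈⁅y⁆⇒x≡y k x∈⁅k⁆)

record RowThrough {s v} (IsRow : Word s v → Set) (i k : Fin s) (p q : Fin v) : Set where
  field
    row   : Word s v
    isRow : IsRow row
    at-i  : lookup row i ≡ p
    at-k  : lookup row k ≡ q

record IsOrthogonalArray {s v} (IsRow : Word s v → Set) : Set where
  field
    cover  : ∀ {i k} → i ≢ k → ∀ p q → RowThrough IsRow i k p q
    unique : ∀ {i k} → i ≢ k → ∀ {x y} → IsRow x → IsRow y →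
             lookup x i ≡ lookup y i → lookup x k ≡ lookup y k → x ≡ y

module _ {s v} {φ : Word s v ⤖ Word s v} (aont : IsAONT 2 s v φ) where
  open Bijection φ renaming (to to f)
  open IsAONT aont

  preimage-isOrthogonalArray : ∀ J → ∣ J ∣ ≡ 2 → ∀ b →
                               IsOrthogonalArray (λ x → AgreeOff J (f x) b)
  preimage-isOrthogonalArray J ∣J∣≡2 b = record { cover = cover ; unique = unique }
    where
    cover : ∀ {i k} → i ≢ k → ∀ p q → RowThrough (λ x → AgreeOff J (f x) b) i k p q
    cover {i} {k} i≢k p q
      with exactlyOne (⁅ i ⁆ ∪ ⁅ k ⁆) J (∣⁅i⁆∪⁅k⁆∣≡2 i≢k) ∣J∣≡2 (replicate s p [ k ]≔ q) b
    ... | x , (x≈a , fx≈b) , _ = record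
      { row   = x
      ; isRow = fx≈b
      ; at-i  = trans (x≈a i (i∈⁅i⁆∪⁅k⁆ i k))
                  (trans (lookup∘update′ i≢k (replicate s p) q) (lookup-replicate i p))
      ; at-k  = trans (x≈a k (k∈⁅i⁆∪⁅k⁆ i k)) (lookup∘update k (replicate s p) q)
      }

    unique : ∀ {i k} → i ≢ k → ∀ {x y} → AgreeOff J (f x) b → AgreeOff J (f y) b →
             lookup x i ≡ lookup y i → lookup x k ≡ lookup y k → x ≡ y
    unique {i} {k} i≢k {x} {y} fx≈b fy≈b xᵢ≡yᵢ xₖ≡yₖ
      with exactlyOne (⁅ i ⁆ ∪ ⁅ k ⁆) J (∣⁅i⁆∪⁅k⁆∣≡2 i≢k) ∣J∣≡2 x b
    ... | _ , _ , onlyOne = trans (onlyOne x (λ _ _ → refl) fx≈b) (sym (onlyOne y y≈x fy≈b))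
      where
      y≈x : AgreeOn (⁅ i ⁆ ∪ ⁅ k ⁆) y x
      y≈x j j∈ with x∈⁅i⁆∪⁅k⁆⇒x≡i⊎x≡k i k j∈
      ... | inj₁ refl = sym xᵢ≡yᵢ
      ... | inj₂ refl = sym xₖ≡yₖ

module _ {s v} {IsRow : Word (2 + s) (suc v) → Set} (oa : IsOrthogonalArray IsRow) where
  open IsOrthogonalArray oa
  open RowThrough

  private
    other : Fin (2 + s) → Fin (2 + s)
    other zero    = suc zero
    other (suc _) = zero

    other-≢ : ∀ i → other i ≢ i
    other-≢ zero    ()
    other-≢ (suc _) ()

    0≢1 : zero ≢ other zero
    0≢1 ()

    base : RowThrough IsRow zero (other zero) zero zero
    base = cover 0≢1 zero zero

    r : Word (2 + s) (suc v)
    r = row base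

    lookup-cong : ∀ c {x y : Word (2 + s) (suc v)} → x ≡ y → lookup x c ≡ lookup y c
    lookup-cong c = cong (λ x → lookup x c)

    r-other : ∀ i → lookup r (other i) ≡ zero
    r-other zero    = at-k base
    r-other (suc _) = at-i base

    deviation : (i : Fin (2 + s)) (t : Fin v) →
                RowThrough IsRow (other i) i (suc t) (lookup r i)
    deviation i t = cover (other-≢ i) (suc t) (lookup r i)

    pick : Fin 1 ⊎ (Fin (2 + s) × Fin v) → Word (2 + s) (suc v)
    pick (inj₁ _)       = r
    pick (inj₂ (i , t)) = row (deviation i t)

    pick-isRow : ∀ a → IsRow (pick a)
    pick-isRow (inj₁ _)       = isRow base
    pick-isRow (inj₂ (i , t)) = isRow (deviation i t)

    deviation-≢-r : ∀ i t → row (deviation i t) ≢ r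
    deviation-≢-r i t eq
      with trans (sym (at-i (deviation i t))) (trans (lookup-cong (other i) eq) (r-other i))
    ... | ()

    pick-injective : ∀ {a b} → pick a ≡ pick b → a ≡ b
    pick-injective {inj₁ zero}     {inj₁ zero}     _  = refl
    pick-injective {inj₁ _}        {inj₂ (i , t)}  eq = ⊥-elim (deviation-≢-r i t (sym eq))
    pick-injective {inj₂ (i , t)}  {inj₁ _}        eq = ⊥-elim (deviation-≢-r i t eq)
    pick-injective {inj₂ (i , t)}  {inj₂ (j , t′)} eq with i ≟ j
    ... | yes refl = cong (λ u → inj₂ (i , u)) (suc-injective (begin
      suc t                                   ≡⟨ at-i (deviation i t) ⟨
      lookup (pick (inj₂ (i , t))) (other i)  ≡⟨ lookup-cong (other i) eq ⟩
      lookup (pick (inj₂ (i , t′))) (other i) ≡⟨ at-i (deviation i t′) ⟩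
      suc t′                                  ∎))
      where open ≡-Reasoning
    ... | no i≢j = ⊥-elim (deviation-≢-r i t
      (unique i≢j (isRow (deviation i t)) (isRow base)
        (at-k (deviation i t)) (trans (lookup-cong j eq) (at-k (deviation j t′)))))

    entries : Fin 1 ⊎ (Fin (2 + s) × Fin v) → Fin (suc v) × Fin (suc v)
    entries a = lookup (pick a) zero , lookup (pick a) (other zero)

    entries-injective : ∀ {a b} → entries a ≡ entries b → a ≡ b
    entries-injective {a} {b} eq with ,-injective eq
    ... | e₀ , e₁ = pick-injective (unique 0≢1 (pick-isRow a) (pick-isRow b) e₀ e₁)

  orthogonalArray-size : 1 + (2 + s) * v ≤ suc v * suc v
  orthogonalArray-size = ↣⇒≤ (↔-trans +↔⊎ (↔-refl ⊎-↔ *↔×)) *↔× (mk↣ entries-injective)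

orthogonalArray-columns : ∀ {s w} {IsRow : Word (2 + s) (2 + w) → Set} →
                          IsOrthogonalArray IsRow → 2 + s ≤ 2 + w + 1
orthogonalArray-columns {s} {w} oa = *-cancelʳ-≤ (2 + s) (2 + w + 1) (suc w)
  (≤-pred (≤-trans (orthogonalArray-size oa) (≤-reflexive (square-identity w))))
  where
  square-identity : ∀ w → (2 + w) * (2 + w) ≡ 1 + (2 + w + 1) * (1 + w)
  square-identity = solve-∀

corollary24 : (v s : ℕ) → 2 ≤ v → 2 ≤ s → AONT 2 s v → s ≤ v + 1
corollary24 (suc (suc _)) (suc (suc s)) (s≤s (s≤s _)) (s≤s (s≤s _)) (_ , aont) =
  orthogonalArray-columns (preimage-isOrthogonalArray aont J (∣⁅i⁆∪⁅k⁆∣≡2 0≢1) (replicate _ zero))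
  where
  J : Subset (2 + s)
  J = ⁅ zero ⁆ ∪ ⁅ suc zero ⁆

  0≢1 : zero ≢ suc {1 + s} zero
  0≢1 ()
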